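{- Let $G$ be an abelian group, let $G_0 \subseteq G$ and let $H = \mathcal{B}_{\pm}(G_0)$. (1) $H$ is half-factorial if and only if $\mathsf{D}(H) \le 2$. (2) If $\Delta(H) \neq \emptyset$ and $\mathsf{D}(H)$ is finite, then $\min \Delta(H)$ divides $\mathsf{D}(H) - 2$.
   Context: For a subset $G_0$ of an abelian group $G$, a sequence over $G_0$ is a finite unordered list $S = g_1\cdots g_\ell$ of elements of $G_0$ (repetitions allowed), forming the free commutative monoid over $G_0$ under concatenation; $|S|=\ell$. $S$ is a plus-minus weighted zero-sum sequence if $\sum_i \epsilon_i g_i = 0$ for some $\epsilon_i\in\{+1,-1\}$; $\mathcal{B}_{\pm}(G_0)$ is the monoid of these. For a monoid $H$ with trivial unit group: an atom is a non-identity element not a product of two non-identity elements; $\mathsf{L}_H(a)$ is the set of $k$ such that $a$ is a product of $k$ atoms; $H$ is half-factorial if $|\mathsf{L}_H(a)|=1$ for every $a\in H$; for finite $L=\{a_0<\dots<a_k\}$, $\Delta(L)=\{a_i-a_{i-1}\}$; $\Delta(H)=\bigcup_{a\in H}\Delta(\mathsf{L}_H(a))$. $\mathsf{D}(H)=\sup\{|A|\colon A \text{ an atom of } H\}$ (with $\sup\emptyset = 0$). -}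

module Defs where

open import Level using (Level; _⊔_)
open import Algebra.Bundles using (AbelianGroup)
open import Data.List using (List; []; _∷_; _++_; length; concat)
open import Data.List.Relation.Unary.All using (All)
open import Data.Nat using (ℕ; _≤_; _<_; _+_)
open import Data.Product using (Σ; ∃; _×_)
open import Relation.Nullary using (¬_)
open import Relation.Binary.PropositionalEquality using (_≡_; _≢_)
open import Relation.Unary using (Pred)
import Data.List.Relation.Binary.Permutation.Setoid as Perm

module PlusMinus {c ℓ : Level} (G : AbelianGroup c ℓ) {ℓ₀ : Level} (G0 : Pred (AbelianGroup.Carrier G) ℓ₀) where
  open AbelianGroup G
  open Perm setoid using (_↭_)

  -- sequences over G: finite lists, considered up to permutation (multiset equality) via _↭_
  Seq : Set c
  Seq = List Carrier

  data SignedSum : Seq → Carrier → Set c where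
    nil   : SignedSum [] ε
    plus  : ∀ {g S x} → SignedSum S x → SignedSum (g ∷ S) (g ∙ x)
    minus : ∀ {g S x} → SignedSum S x → SignedSum (g ∷ S) (g ⁻¹ ∙ x)

  PMZeroSum : Seq → Set (c ⊔ ℓ)
  PMZeroSum S = Σ Carrier (λ x → SignedSum S x × x ≈ ε)

  InH : Seq → Set (c ⊔ ℓ ⊔ ℓ₀)
  InH S = All G0 S × PMZeroSum S

  -- atoms of H (identity of H = empty sequence; unit group trivial)
  Atom : Seq → Set (c ⊔ ℓ ⊔ ℓ₀)
  Atom A = InH A × A ≢ [] ×
    ¬ (Σ Seq λ B → Σ Seq λ C → InH B × InH C × B ≢ [] × C ≢ [] × A ↭ (B ++ C))

  InL : Seq → ℕ → Set (c ⊔ ℓ ⊔ ℓ₀)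
  InL S k = Σ (List Seq) λ As → length As ≡ k × All Atom As × S ↭ concat As

  HalfFactorial : Set (c ⊔ ℓ ⊔ ℓ₀)
  HalfFactorial = ∀ S → InH S → ∀ k l → InL S k → InL S l → k ≡ l

  DLe : ℕ → Set (c ⊔ ℓ ⊔ ℓ₀)
  DLe n = ∀ A → Atom A → length A ≤ n

  -- D(H) = D (supremum of atom lengths, sup ∅ = 0; in particular D(H) finite)
  IsD : ℕ → Set (c ⊔ ℓ ⊔ ℓ₀)
  IsD D = DLe D × (∀ N → DLe N → D ≤ N)

  InΔ : ℕ → Set (c ⊔ ℓ ⊔ ℓ₀)
  InΔ d = Σ Seq λ S → InH S × Σ ℕ λ k →
    1 ≤ d × InL S k × InL S (k + d) × (∀ j → InL S j → ¬ (k < j × j < k + d))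

  IsMinΔ : ℕ → Set (c ⊔ ℓ ⊔ ℓ₀)
  IsMinΔ m = InΔ m × (∀ d → InΔ d → m ≤ d)

{-# OPTIONS --safe #-}
module Submission where

-- In an atom A with |A| ≥ 2 no term is 0 (it could be split off), so A·A is also the product of
-- the |A| atoms g·g (g ∈ A): A·A has factorizations of lengths 2 and |A|, and half-factoriality
-- forces D(H) ≤ 2. Conversely, if D(H) ≤ 2 every atom is a single term 0 or two nonzero terms,
-- so a factorization of S into k atoms satisfies 2k = |S| + (number of zero terms of S).
-- For (2) let m = min Δ(H), witnessed by k, k + m ∈ L(S), let A be an atom of length D and write
-- D − 2 = qm + r with r < m. Then A·A·S^q has factorizations of lengths 2 + q(k + m) and
-- D + qk = 2 + q(k + m) + r; if r > 0, consecutive lengths between these two give an element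
-- of Δ(H) of size at most r < m.
-- All conclusions are decidable, so the classical steps (counting zeros, choosing consecutive
-- lengths, choosing an atom of maximal length) are carried out under double negation.

open import Defs
open import Level using (Level; _⊔_)
open import Function using (_∘_)
open import Algebra.Bundles using (AbelianGroup)
import Algebra.Properties.Group as GroupProperties
open import Data.Nat using (ℕ; zero; suc; _+_; _*_; _∸_; _≤_; _<_; z≤n; s≤s; _≤?_; _≟_; NonZero; >-nonZero)
open import Data.Nat.Properties
  using ( ≤-refl; ≤-trans; <⇒≤; ≰⇒>; <⇒≱; ≤-reflexive; ≤-pred; ≤∧≢⇒<; n≮n; n≢0⇒n>0; m<n⇒0<n∸m
        ; m+[n∸m]≡n; m+1+n≢0; suc-injective; *-suc; *-cancelˡ-≡; +-cancelˡ-<; +-monoˡ-<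
        ; +-commutativeSemigroup)
open import Algebra.Properties.CommutativeSemigroup +-commutativeSemigroup using (interchange)
open import Data.Nat.Divisibility using (_∣_; _∣?_; _∣0; m%n≡0⇒n∣m)
open import Data.Nat.DivMod using (_%_; _/_; m%n<n; m≡m%n+[m/n]*n)
open import Data.Nat.Induction using (<-rec)
open import Data.Nat.Tactic.RingSolver using (solve-∀)
open import Data.Product using (Σ; ∃; ∃₂; _×_; _,_; proj₁)
open import Data.List using (List; []; _∷_; _++_; [_]; length; concat; map; replicate)
open import Data.List.Properties using (length-++; length-map; ++-identityʳ; concat-++)
open import Data.List.Relation.Unary.All as All using (All; []; _∷_)
open import Data.List.Relation.Unary.All.Properties using (++⁺; ++⁻; map⁺)
open import Data.List.Relation.Unary.Any using (Any; here; there)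
open import Data.List.Membership.Propositional using (_∈_)
open import Data.List.Membership.Propositional.Properties using (∈-∃++)
open import Data.List.Relation.Binary.Pointwise using (Pointwise; []; _∷_)
import Data.List.Relation.Binary.Permutation.Setoid as Permutation
import Data.List.Relation.Binary.Permutation.Setoid.Properties as PermutationProperties
open import Relation.Unary using (Pred)
open import Relation.Nullary using (¬_; yes; no)
open import Relation.Nullary.Negation using (Stable; contradiction)
open import Relation.Nullary.Decidable using (decidable-stable)
open import Relation.Binary.PropositionalEquality as ≡ using (_≡_; _≢_; cong; cong₂; subst)
open ≡.≡-Reasoning

stable-cases : ∀ {a b} {P : Set a} {Q : Set b} → Stable Q → (P → Q) → (¬ P → Q) → Q
stable-cases stable f g = stable λ ¬q → ¬q (g (¬q ∘ f))

2≤|xs++x∷ys|⇒xs++ys≢[] : ∀ {a} {A : Set a} (xs ys : List A) {x} → 2 ≤ length (xs ++ x ∷ ys) → xs ++ ys ≢ []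
2≤|xs++x∷ys|⇒xs++ys≢[] []      []      (s≤s ())
2≤|xs++x∷ys|⇒xs++ys≢[] []      (_ ∷ _) _ ()
2≤|xs++x∷ys|⇒xs++ys≢[] (_ ∷ _) _       _ ()

module _ {c ℓ ℓ₀ : Level} (G : AbelianGroup c ℓ) (G0 : Pred (AbelianGroup.Carrier G) ℓ₀) where
  open AbelianGroup G
  open GroupProperties group using (ε⁻¹≈ε; ⁻¹-injective)
  open PlusMinus G G0
  open Permutation setoid using (_↭_; ↭-refl; ↭-sym; ↭-trans; ↭-reflexive; ↭-prep)
  module ↭ = Permutation setoid
  open PermutationProperties setoid using (↭-shift; ∈-resp-↭; xs↭ys⇒|xs|≡|ys|) renaming (++⁺ to ↭-++⁺)

  x⁻¹≈ε⇒x≈ε : ∀ {x} → x ⁻¹ ≈ ε → x ≈ ε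
  x⁻¹≈ε⇒x≈ε x⁻¹≈ε = ⁻¹-injective (trans x⁻¹≈ε (sym ε⁻¹≈ε))

  x≈ε⇒x⁻¹≈ε : ∀ {x} → x ≈ ε → x ⁻¹ ≈ ε
  x≈ε⇒x⁻¹≈ε x≈ε = trans (⁻¹-cong x≈ε) ε⁻¹≈ε

  x≈ε⇒x∙y≈y : ∀ {x y} → x ≈ ε → x ∙ y ≈ y
  x≈ε⇒x∙y≈y {y = y} x≈ε = trans (∙-congʳ x≈ε) (identityˡ y)

  signedSum-++ : ∀ {S T x y} → SignedSum S x → SignedSum T y → ∃ λ z → SignedSum (S ++ T) z × z ≈ x ∙ y
  signedSum-++ {y = y} nil t = y , t , sym (identityˡ y)
  signedSum-++ {y = y} (plus {g} {x = x} s) t with z , st , z≈ ← signedSum-++ s t =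
    g ∙ z , plus st , trans (∙-congˡ z≈) (sym (assoc g x y))
  signedSum-++ {y = y} (minus {g} {x = x} s) t with z , st , z≈ ← signedSum-++ s t =
    g ⁻¹ ∙ z , minus st , trans (∙-congˡ z≈) (sym (assoc (g ⁻¹) x y))

  signedSum-dropZero : ∀ {g ys x} → g ≈ ε → ∀ xs → SignedSum (xs ++ g ∷ ys) x →
                       ∃ λ x′ → SignedSum (xs ++ ys) x′ × x′ ≈ x
  signedSum-dropZero g≈ε [] (plus {x = x} s)  = x , s , sym (x≈ε⇒x∙y≈y g≈ε)
  signedSum-dropZero g≈ε [] (minus {x = x} s) = x , s , sym (x≈ε⇒x∙y≈y (x≈ε⇒x⁻¹≈ε g≈ε))
  signedSum-dropZero g≈ε (h ∷ xs) (plus s) with x′ , s′ , x′≈ ← signedSum-dropZero g≈ε xs s =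
    h ∙ x′ , plus s′ , ∙-congˡ x′≈
  signedSum-dropZero g≈ε (h ∷ xs) (minus s) with x′ , s′ , x′≈ ← signedSum-dropZero g≈ε xs s =
    h ⁻¹ ∙ x′ , minus s′ , ∙-congˡ x′≈

  InH-[] : InH []
  InH-[] = [] , ε , nil , refl

  InH-++ : ∀ {S T} → InH S → InH T → InH (S ++ T)
  InH-++ (S⊆G0 , x , sx , x≈ε) (T⊆G0 , y , sy , y≈ε) with z , sz , z≈ ← signedSum-++ sx sy =
    ++⁺ S⊆G0 T⊆G0 , z , sz , trans z≈ (trans (∙-cong x≈ε y≈ε) (identityˡ ε))

  InH-replicate : ∀ {S} → InH S → ∀ q → InH (concat (replicate q S))
  InH-replicate S∈H zero    = InH-[]
  InH-replicate S∈H (suc q) = InH-++ S∈H (InH-replicate S∈H q)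

  InH-dropZero : ∀ {g ys} → g ≈ ε → ∀ xs → InH (xs ++ g ∷ ys) → InH (xs ++ ys)
  InH-dropZero g≈ε xs (S⊆G0 , x , sx , x≈ε)
    with xs⊆G0 , _ ∷ ys⊆G0 ← ++⁻ xs S⊆G0 | x′ , sx′ , x′≈ ← signedSum-dropZero g≈ε xs sx =
    ++⁺ xs⊆G0 ys⊆G0 , x′ , sx′ , trans x′≈ x≈ε

  InH-[g]⇒g≈ε : ∀ {g} → InH [ g ] → g ≈ ε
  InH-[g]⇒g≈ε {g} (_ , _ , plus nil , g∙ε≈ε)    = trans (sym (identityʳ g)) g∙ε≈ε
  InH-[g]⇒g≈ε {g} (_ , _ , minus nil , g⁻¹∙ε≈ε) = x⁻¹≈ε⇒x≈ε (trans (sym (identityʳ (g ⁻¹))) g⁻¹∙ε≈ε)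

  g≈ε⇒InH-[g] : ∀ {g} → G0 g → g ≈ ε → InH [ g ]
  g≈ε⇒InH-[g] {g} g∈G0 g≈ε = g∈G0 ∷ [] , g ∙ ε , plus nil , trans (identityʳ g) g≈ε

  atom-nonzero : ∀ {A g} → Atom A → 2 ≤ length A → g ∈ A → ¬ g ≈ ε
  atom-nonzero (A∈H , _ , irreducible) 2≤|A| g∈A g≈ε with xs , ys , ≡.refl ← ∈-∃++ g∈A =
    irreducible ( [ _ ] , xs ++ ys
                , g≈ε⇒InH-[g] (All.lookup (proj₁ A∈H) g∈A) g≈ε , InH-dropZero g≈ε xs A∈H
                , (λ ()) , 2≤|xs++x∷ys|⇒xs++ys≢[] xs ys 2≤|A| , ↭-shift xs ys )

  pair : Carrier → Seq
  pair g = g ∷ g ∷ []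

  pair-atom : ∀ {g} → G0 g → ¬ g ≈ ε → Atom (pair g)
  pair-atom {g} g∈G0 g≉ε = (g∈G0 ∷ g∈G0 ∷ [] , g ∙ (g ⁻¹ ∙ ε) , plus (minus nil) , g-g≈ε) , (λ ()) , irreducible
    where
    g-g≈ε : g ∙ (g ⁻¹ ∙ ε) ≈ ε
    g-g≈ε = trans (∙-congˡ (identityʳ (g ⁻¹))) (inverseʳ g)

    ∈pair⇒≈ : ∀ {b} → Any (b ≈_) (pair g) → b ≈ g
    ∈pair⇒≈ (here b≈g)         = b≈g
    ∈pair⇒≈ (there (here b≈g)) = b≈g

    irreducible : ¬ (Σ Seq λ B → Σ Seq λ C → InH B × InH C × B ≢ [] × C ≢ [] × pair g ↭ B ++ C)
    irreducible ([] , _ , _ , _ , B≢[] , _)    = B≢[] ≡.refl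
    irreducible (_ , [] , _ , _ , _ , C≢[] , _) = C≢[] ≡.refl
    irreducible (b ∷ [] , _ ∷ _ , [b]∈H , _ , _ , _ , gg↭) =
      g≉ε (trans (sym (∈pair⇒≈ (∈-resp-↭ (↭-sym gg↭) (here refl)))) (InH-[g]⇒g≈ε [b]∈H))
    irreducible (_ ∷ _ ∷ B , c ∷ C , _ , _ , _ , _ , gg↭) =
      m+1+n≢0 (length B) (≡.sym (≡.trans (suc-injective (suc-injective (xs↭ys⇒|xs|≡|ys| gg↭))) (length-++ B)))

  atom⇒InL-1 : ∀ {A} → Atom A → InL A 1
  atom⇒InL-1 {A} atA = [ A ] , ≡.refl , atA ∷ [] , ↭-reflexive (≡.sym (++-identityʳ A))

  InL-++ : ∀ {S T k l} → InL S k → InL T l → InL (S ++ T) (k + l)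
  InL-++ (As , ≡.refl , As-atoms , S↭) (Bs , ≡.refl , Bs-atoms , T↭) =
    As ++ Bs , length-++ As , ++⁺ As-atoms Bs-atoms , ↭-trans (↭-++⁺ S↭ T↭) (↭-reflexive (concat-++ As Bs))

  InL-replicate : ∀ {S k} → InL S k → ∀ q → InL (concat (replicate q S)) (q * k)
  InL-replicate _   zero    = [] , ≡.refl , [] , ↭-refl
  InL-replicate k∈L (suc q) = InL-++ k∈L (InL-replicate k∈L q)

  InL-atom² : ∀ {A} → Atom A → InL (A ++ A) 2
  InL-atom² atA = InL-++ (atom⇒InL-1 atA) (atom⇒InL-1 atA)

  ++-self↭concat-pairs : ∀ A → A ++ A ↭ concat (map pair A)
  ++-self↭concat-pairs []      = ↭-refl
  ++-self↭concat-pairs (g ∷ A) = ↭-prep g (↭-trans (↭-shift A A) (↭-prep g (++-self↭concat-pairs A)))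

  InL-atom²-|A| : ∀ {A} → Atom A → 2 ≤ length A → InL (A ++ A) (length A)
  InL-atom²-|A| {A} atA 2≤|A| =
    map pair A , length-map pair A , map⁺ (All.tabulate pair-atom′) , ++-self↭concat-pairs A
    where
    pair-atom′ : ∀ {g} → g ∈ A → Atom (pair g)
    pair-atom′ g∈A = pair-atom (All.lookup (proj₁ (proj₁ atA)) g∈A) (atom-nonzero atA 2≤|A| g∈A)

  halfFactorial⇒D≤2 : HalfFactorial → DLe 2
  halfFactorial⇒D≤2 hf A atA with 2 ≤? length A
  ... | yes 2≤|A| = ≤-reflexive (≡.sym (hf (A ++ A) (InH-++ (proj₁ atA) (proj₁ atA)) 2 (length A)
                                         (InL-atom² atA) (InL-atom²-|A| atA 2≤|A|)))
  ... | no 2≰|A|  = <⇒≤ (≰⇒> 2≰|A|)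

  data ZeroCount : Seq → ℕ → Set (c ⊔ ℓ) where
    []       : ZeroCount [] 0
    zero∷    : ∀ {g S n} → g ≈ ε → ZeroCount S n → ZeroCount (g ∷ S) (suc n)
    nonzero∷ : ∀ {g S n} → ¬ g ≈ ε → ZeroCount S n → ZeroCount (g ∷ S) n

  ¬¬ZeroCount : ∀ S → ¬ ¬ ∃ (ZeroCount S)
  ¬¬ZeroCount []      none = none (0 , [])
  ¬¬ZeroCount (g ∷ S) none = ¬¬ZeroCount S λ (n , zc) →
    none (n , nonzero∷ (λ g≈ε → none (suc n , zero∷ g≈ε zc)) zc)

  ZeroCount-∷-resp : ∀ {g h S T n} → g ≈ h → (∀ {k} → ZeroCount S k → ZeroCount T k) →
                     ZeroCount (g ∷ S) n → ZeroCount (h ∷ T) n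
  ZeroCount-∷-resp g≈h S⇒T (zero∷ g≈ε zc)    = zero∷ (trans (sym g≈h) g≈ε) (S⇒T zc)
  ZeroCount-∷-resp g≈h S⇒T (nonzero∷ g≉ε zc) = nonzero∷ (g≉ε ∘ trans g≈h) (S⇒T zc)

  ZeroCount-swap : ∀ {g h S n} → ZeroCount (g ∷ h ∷ S) n → ZeroCount (h ∷ g ∷ S) n
  ZeroCount-swap (zero∷ g≈ε (zero∷ h≈ε zc))       = zero∷ h≈ε (zero∷ g≈ε zc)
  ZeroCount-swap (zero∷ g≈ε (nonzero∷ h≉ε zc))    = nonzero∷ h≉ε (zero∷ g≈ε zc)
  ZeroCount-swap (nonzero∷ g≉ε (zero∷ h≈ε zc))    = zero∷ h≈ε (nonzero∷ g≉ε zc)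
  ZeroCount-swap (nonzero∷ g≉ε (nonzero∷ h≉ε zc)) = nonzero∷ h≉ε (nonzero∷ g≉ε zc)

  ZeroCount-resp-≋ : ∀ {S T n} → Pointwise _≈_ S T → ZeroCount S n → ZeroCount T n
  ZeroCount-resp-≋ []          []  = []
  ZeroCount-resp-≋ (g≈h ∷ S≋T) zc = ZeroCount-∷-resp g≈h (ZeroCount-resp-≋ S≋T) zc

  ZeroCount-resp-↭ : ∀ {S T n} → S ↭ T → ZeroCount S n → ZeroCount T n
  ZeroCount-resp-↭ (↭.refl S≋T)       = ZeroCount-resp-≋ S≋T
  ZeroCount-resp-↭ (↭.prep g≈h S↭T)   = ZeroCount-∷-resp g≈h (ZeroCount-resp-↭ S↭T)
  ZeroCount-resp-↭ (↭.swap g≈ h≈ S↭T) =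
    ZeroCount-∷-resp h≈ (ZeroCount-∷-resp g≈ (ZeroCount-resp-↭ S↭T)) ∘ ZeroCount-swap
  ZeroCount-resp-↭ (↭.trans R↭S S↭T)  = ZeroCount-resp-↭ S↭T ∘ ZeroCount-resp-↭ R↭S

  ZeroCount-++⁻ : ∀ S {T n} → ZeroCount (S ++ T) n →
                  ∃₂ λ n₁ n₂ → ZeroCount S n₁ × ZeroCount T n₂ × n ≡ n₁ + n₂
  ZeroCount-++⁻ [] zc = 0 , _ , [] , zc , ≡.refl
  ZeroCount-++⁻ (g ∷ S) (zero∷ g≈ε zc) with n₁ , n₂ , zc₁ , zc₂ , ≡.refl ← ZeroCount-++⁻ S zc =
    suc n₁ , n₂ , zero∷ g≈ε zc₁ , zc₂ , ≡.refl
  ZeroCount-++⁻ (g ∷ S) (nonzero∷ g≉ε zc) with n₁ , n₂ , zc₁ , zc₂ , ≡.refl ← ZeroCount-++⁻ S zc =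
    n₁ , n₂ , nonzero∷ g≉ε zc₁ , zc₂ , ≡.refl

  nonzero⇒ZeroCount-0 : ∀ {S n} → All (λ g → ¬ g ≈ ε) S → ZeroCount S n → n ≡ 0
  nonzero⇒ZeroCount-0 []          []              = ≡.refl
  nonzero⇒ZeroCount-0 (g≉ε ∷ _)   (zero∷ g≈ε _)   = contradiction g≈ε g≉ε
  nonzero⇒ZeroCount-0 (_ ∷ S≉ε)   (nonzero∷ _ zc) = nonzero⇒ZeroCount-0 S≉ε zc

  atom-ZeroCount : DLe 2 → ∀ {A n} → Atom A → ZeroCount A n → length A + n ≡ 2
  atom-ZeroCount _ {[]} (_ , A≢[] , _) _ = contradiction ≡.refl A≢[]
  atom-ZeroCount _ {_ ∷ []} _ (zero∷ _ []) = ≡.refl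
  atom-ZeroCount _ {_ ∷ []} (A∈H , _) (nonzero∷ g≉ε []) = contradiction (InH-[g]⇒g≈ε A∈H) g≉ε
  atom-ZeroCount _ {_ ∷ _ ∷ []} atA zc =
    cong (2 +_) (nonzero⇒ZeroCount-0 (All.tabulate (atom-nonzero atA ≤-refl)) zc)
  atom-ZeroCount D≤2 {A@(_ ∷ _ ∷ _ ∷ _)} atA _ = contradiction (D≤2 A atA) λ { (s≤s (s≤s ())) }

  factorization-ZeroCount : DLe 2 → ∀ {As n} → All Atom As → ZeroCount (concat As) n →
                            length (concat As) + n ≡ 2 * length As
  factorization-ZeroCount _ [] [] = ≡.refl
  factorization-ZeroCount D≤2 {A ∷ As} (atA ∷ atoms) zc with n₁ , n₂ , zc₁ , zc₂ , ≡.refl ← ZeroCount-++⁻ A zc =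
    begin
      length (A ++ concat As) + (n₁ + n₂)          ≡⟨ cong (_+ (n₁ + n₂)) (length-++ A) ⟩
      length A + length (concat As) + (n₁ + n₂)    ≡⟨ interchange (length A) _ n₁ n₂ ⟩
      (length A + n₁) + (length (concat As) + n₂)  ≡⟨ cong₂ _+_ (atom-ZeroCount D≤2 atA zc₁)
                                                                 (factorization-ZeroCount D≤2 atoms zc₂) ⟩
      2 + 2 * length As                            ≡⟨ ≡.sym (*-suc 2 (length As)) ⟩
      2 * suc (length As)                          ∎

  D≤2⇒halfFactorial : DLe 2 → HalfFactorial
  D≤2⇒halfFactorial D≤2 S _ _ _ (As , ≡.refl , As-atoms , S↭As) (Bs , ≡.refl , Bs-atoms , S↭Bs) =
    decidable-stable (length As ≟ length Bs) λ k≢l → ¬¬ZeroCount S λ (n , zc) → k≢l (*-cancelˡ-≡ _ _ 2 (begin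
      2 * length As           ≡⟨ ≡.sym (factorization-ZeroCount D≤2 As-atoms (ZeroCount-resp-↭ S↭As zc)) ⟩
      length (concat As) + n  ≡⟨ cong (_+ n) (≡.sym (xs↭ys⇒|xs|≡|ys| S↭As)) ⟩
      length S + n            ≡⟨ cong (_+ n) (xs↭ys⇒|xs|≡|ys| S↭Bs) ⟩
      length (concat Bs) + n  ≡⟨ factorization-ZeroCount D≤2 Bs-atoms (ZeroCount-resp-↭ S↭Bs zc) ⟩
      2 * length Bs           ∎))

  lowerBoundΔ≤lengthGap : ∀ {m} → (∀ d → InΔ d → m ≤ d) → ∀ {T} → InH T →
                          ∀ r {x} → 1 ≤ r → InL T x → InL T (x + r) → m ≤ r
  lowerBoundΔ≤lengthGap {m} m≤Δ {T} T∈H = <-rec _ gap≥m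
    where
    gap≥m : ∀ r → (∀ {r′} → r′ < r → ∀ {x} → 1 ≤ r′ → InL T x → InL T (x + r′) → m ≤ r′) →
            ∀ {x} → 1 ≤ r → InL T x → InL T (x + r) → m ≤ r
    gap≥m r shorter {x} 1≤r x∈L x+r∈L = stable-cases (decidable-stable (m ≤? r)) via-intermediate
      (λ none → m≤Δ r (T , T∈H , x , 1≤r , x∈L , x+r∈L , λ j j∈L x<j<x+r → none (j , j∈L , x<j<x+r)))
      where
      via-intermediate : (∃ λ j → InL T j × x < j × j < x + r) → m ≤ r
      via-intermediate (j , j∈L , x<j , j<x+r) =
        ≤-trans (shorter b<r (m<n⇒0<n∸m j<x+r) j∈L (subst (InL T) (≡.sym j+b≡x+r) x+r∈L)) (<⇒≤ b<r)
        where
        b = x + r ∸ j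
        j+b≡x+r : j + b ≡ x + r
        j+b≡x+r = m+[n∸m]≡n (<⇒≤ j<x+r)
        b<r : b < r
        b<r = +-cancelˡ-< x b r (subst (x + b <_) j+b≡x+r (+-monoˡ-< b x<j))

  minΔ∣|A|∸2 : ∀ {m A} → IsMinΔ m → Atom A → 2 ≤ length A → m ∣ length A ∸ 2
  minΔ∣|A|∸2 {m} {A} ((S , S∈H , k , 1≤m , k∈L , k+m∈L , _) , m≤Δ) atA 2≤|A| =
    decidable-stable (m ∣? n) λ m∤n →
      contradiction (lowerBoundΔ≤lengthGap m≤Δ T∈H r (n≢0⇒n>0 (m∤n ∘ m%n≡0⇒n∣m n m)) short long)
                    (<⇒≱ (m%n<n n m))
    where
    instance
      m≢0 : NonZero m
      m≢0 = >-nonZero 1≤m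
    n q r : ℕ
    n = length A ∸ 2
    q = n / m
    r = n % m
    T : Seq
    T = (A ++ A) ++ concat (replicate q S)
    T∈H : InH T
    T∈H = InH-++ (InH-++ (proj₁ atA) (proj₁ atA)) (InH-replicate S∈H q)
    short : InL T (2 + q * (k + m))
    short = InL-++ (InL-atom² atA) (InL-replicate k+m∈L q)
    rearrange : ∀ r q m k → 2 + (r + q * m) + q * k ≡ 2 + q * (k + m) + r
    rearrange = solve-∀
    long : InL T (2 + q * (k + m) + r)
    long = subst (InL T) |A|+qk≡ (InL-++ (InL-atom²-|A| atA 2≤|A|) (InL-replicate k∈L q))
      where
      |A|+qk≡ : length A + q * k ≡ 2 + q * (k + m) + r
      |A|+qk≡ = begin
        length A + q * k         ≡⟨ cong (_+ q * k) (≡.sym (m+[n∸m]≡n 2≤|A|)) ⟩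
        2 + n + q * k            ≡⟨ cong (λ n → 2 + n + q * k) (m≡m%n+[m/n]*n n m) ⟩
        2 + (r + q * m) + q * k  ≡⟨ rearrange r q m k ⟩
        2 + q * (k + m) + r      ∎

  ¬¬atom-of-length : ∀ {D} → IsD (suc D) → ¬ ¬ (∃ λ A → Atom A × length A ≡ suc D)
  ¬¬atom-of-length {D} (atoms≤D , D-least) none = n≮n D (D-least D atoms≤D-1)
    where
    atoms≤D-1 : DLe D
    atoms≤D-1 A atA = ≤-pred (≤∧≢⇒< (atoms≤D A atA) (λ |A|≡D → none (A , atA , |A|≡D)))

  minΔ∣D∸2 : ∀ D → IsD D → ∀ m → IsMinΔ m → m ∣ D ∸ 2
  minΔ∣D∸2 0 _ m _ = m ∣0
  minΔ∣D∸2 1 _ m _ = m ∣0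
  minΔ∣D∸2 2 _ m _ = m ∣0
  minΔ∣D∸2 D@(suc (suc (suc _))) isD m minΔ =
    decidable-stable (m ∣? D ∸ 2) λ m∤D∸2 → ¬¬atom-of-length isD λ (A , atA , |A|≡D) →
      let 2≤|A| = subst (2 ≤_) (≡.sym |A|≡D) (s≤s (s≤s z≤n))
      in m∤D∸2 (subst (λ l → m ∣ l ∸ 2) |A|≡D (minΔ∣|A|∸2 minΔ atA 2≤|A|))

lemma4p3 : {c ℓ ℓ₀ : Level} (G : AbelianGroup c ℓ) (G0 : Pred (AbelianGroup.Carrier G) ℓ₀) →
    ((PlusMinus.HalfFactorial G G0 → PlusMinus.DLe G G0 2) × (PlusMinus.DLe G G0 2 → PlusMinus.HalfFactorial G G0))
    × (Σ ℕ (PlusMinus.InΔ G G0) → ∀ D → PlusMinus.IsD G G0 D → ∀ m → PlusMinus.IsMinΔ G G0 m → m ∣ D ∸ 2)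
lemma4p3 G G0 = (halfFactorial⇒D≤2 G G0 , D≤2⇒halfFactorial G G0) , λ _ → minΔ∣D∸2 G G0
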